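{- Let $\mathbf L=(L,\vee,\wedge)$ be a distributive lattice and $S$ a non-empty subset of $L$, and put $(x,y)':=(y,x)$ for all $(x,y)\in L^2$. Let \[P_S(\mathbf L):=\{(x,y)\in L^2\mid x\wedge y\leq z\leq x\vee y\text{ for all }z\in S\}.\] Then (i) $\big(P_S(\mathbf L),\sqcup,\sqcap\big)$ is a distributive sublattice of $(L^2,\sqcup,\sqcap)$; (ii) $\mathbf P_S(\mathbf L):=\big(P_S(\mathbf L),\sqcup,\sqcap,{}'\big)$ is a Kleene lattice.
   Context: The full twist-product of a lattice $\mathbf L=(L,\vee,\wedge)$ is the lattice $(L^2,\sqcup,\sqcap)$ with $(x,y)\sqcup(z,v):=(x\vee z,y\wedge v)$ and $(x,y)\sqcap(z,v):=(x\wedge z,y\vee v)$; its order is $(x,y)\sqsubseteq(z,v)$ iff $x\leq z$ and $v\leq y$. An antitone involution on a poset is a map $'$ with $x\leq y\Rightarrow y'\leq x'$ and $x''=x$. A Kleene lattice is a distributive lattice with an antitone involution $'$ satisfying the normality condition $x\wedge x'\leq y\vee y'$ for all $x,y$. -}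

module Defs where

open import Level using (Level) renaming (_⊔_ to _⊔ˡ_)
open import Data.Product using (Σ; _×_; _,_; proj₁; proj₂; ∃)
open import Relation.Binary using (Rel)
open import Algebra.Core using (Op₁; Op₂)
open import Algebra.Lattice.Bundles using (DistributiveLattice)
open import Algebra.Lattice.Structures using (IsDistributiveLattice)

module _ {c ℓ : Level} {A : Set c} (_≈_ : Rel A ℓ) (_∧_ : Op₂ A) where
  LatLeq : Rel A ℓ
  LatLeq x y = (x ∧ y) ≈ x

record IsKleeneLattice {c ℓ : Level} {A : Set c} (_≈_ : Rel A ℓ)
         (_∨_ _∧_ : Op₂ A) (_′ : Op₁ A) : Set (c ⊔ˡ ℓ) where
  field
    isDistributiveLattice : IsDistributiveLattice _≈_ _∨_ _∧_
    ′-cong     : ∀ {x y} → x ≈ y → (x ′) ≈ (y ′)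
    antitone   : ∀ {x y} → LatLeq _≈_ _∧_ x y → LatLeq _≈_ _∧_ (y ′) (x ′)
    involutive : ∀ x → ((x ′) ′) ≈ x
    normal     : ∀ x y → LatLeq _≈_ _∧_ (x ∧ (x ′)) (y ∨ (y ′))

module TwistProduct {c ℓ : Level} (L : DistributiveLattice c ℓ) where
  open DistributiveLattice L

  _≤_ : Rel Carrier ℓ
  _≤_ = LatLeq _≈_ _∧_

  _⊔_ : Op₂ (Carrier × Carrier)
  (x , y) ⊔ (z , v) = (x ∨ z , y ∧ v)

  _⊓_ : Op₂ (Carrier × Carrier)
  (x , y) ⊓ (z , v) = (x ∧ z , y ∨ v)

  _≈²_ : Rel (Carrier × Carrier) ℓ
  (x , y) ≈² (z , v) = (x ≈ z) × (y ≈ v)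

  swap′ : Op₁ (Carrier × Carrier)
  swap′ (x , y) = (y , x)

  module _ {s : Level} (S : Carrier → Set s) where
    InP : Carrier × Carrier → Set (c ⊔ˡ ℓ ⊔ˡ s)
    InP (x , y) = ∀ z → S z → ((x ∧ y) ≤ z) × (z ≤ (x ∨ y))

    P : Set (c ⊔ˡ ℓ ⊔ˡ s)
    P = Σ (Carrier × Carrier) InP

    _≈P_ : Rel P ℓ
    a ≈P b = proj₁ a ≈² proj₁ b

-- A pair (x , y) lies in P_S exactly when every z ∈ S lies in the interval
-- [x ∧ y , x ∨ y].  By distributivity the interval of (x ∨ z , y ∧ v) contains
-- the intersection of the intervals of (x , y) and (z , v), and ⊓ is ⊔
-- conjugated by the swap, which preserves every interval; so P_S is a
-- sublattice of the twist-product L × Lᵒᵖ.  For normality, one fixed w ∈ S lies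
-- in all intervals, whence x ∧ y ≤ w ≤ z ∨ v for any (x , y), (z , v) in P_S.
module Submission where

open import Defs
open import Level using (Level)
open import Data.Product using (Σ; _×_; _,_; proj₁; proj₂; ∃; zip′; _<*>_)
open import Data.Product.Relation.Binary.Pointwise.NonDependent
  using (Pointwise; ×-isEquivalence)
open import Algebra.Core using (Op₂)
open import Relation.Binary using (Rel)
open import Algebra.Lattice.Bundles using (DistributiveLattice)
open import Algebra.Lattice.Structures using (IsDistributiveLattice)
open import Algebra.Lattice.Structures.Biased using (isDistributiveLatticeʳʲᵐ)
open import Algebra.Lattice.Morphism.Structures using (IsLatticeMonomorphism)
import Algebra.Lattice.Morphism.LatticeMonomorphism as LatticeMonomorphism
import Algebra.Lattice.Properties.Lattice as LatticeProperties
import Algebra.Lattice.Properties.DistributiveLattice as DistributiveLatticeProperties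
import Relation.Binary.Lattice as OrderLattice
import Relation.Binary.Lattice.Properties.JoinSemilattice as JoinSemilatticeProperties
import Relation.Binary.Lattice.Properties.MeetSemilattice as MeetSemilatticeProperties
import Relation.Binary.Reasoning.PartialOrder as ≤-Reasoning

module _ {a b ℓ₁ ℓ₂} {A : Set a} {B : Set b}
         {_≈₁_ : Rel A ℓ₁} {_∨₁_ _∧₁_ : Op₂ A}
         {_≈₂_ : Rel B ℓ₂} {_∨₂_ _∧₂_ : Op₂ B} where

  ×-isDistributiveLattice : IsDistributiveLattice _≈₁_ _∨₁_ _∧₁_ →
                            IsDistributiveLattice _≈₂_ _∨₂_ _∧₂_ →
                            IsDistributiveLattice (Pointwise _≈₁_ _≈₂_)
                              (zip′ _∨₁_ _∨₂_) (zip′ _∧₁_ _∧₂_)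
  ×-isDistributiveLattice L M = isDistributiveLatticeʳʲᵐ (record
    { isLattice = record
      { isEquivalence = ×-isEquivalence L.isEquivalence M.isEquivalence
      ; ∨-comm        = λ x y → (L.∨-comm , M.∨-comm) <*> x <*> y
      ; ∨-assoc       = λ x y z → (L.∨-assoc , M.∨-assoc) <*> x <*> y <*> z
      ; ∨-cong        = zip′ L.∨-cong M.∨-cong
      ; ∧-comm        = λ x y → (L.∧-comm , M.∧-comm) <*> x <*> y
      ; ∧-assoc       = λ x y z → (L.∧-assoc , M.∧-assoc) <*> x <*> y <*> z
      ; ∧-cong        = zip′ L.∧-cong M.∧-cong
      ; absorptive    = (λ x y → (L.∨-absorbs-∧ , M.∨-absorbs-∧) <*> x <*> y)
                      , (λ x y → (L.∧-absorbs-∨ , M.∧-absorbs-∨) <*> x <*> y)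
      }
    ; ∨-distribʳ-∧ = λ x y z → (L.∨-distribʳ-∧ , M.∨-distribʳ-∧) <*> x <*> y <*> z
    })
    where module L = IsDistributiveLattice L
          module M = IsDistributiveLattice M

module TwistProductProperties {c ℓ : Level} (L : DistributiveLattice c ℓ) where
  open DistributiveLattice L
  open TwistProduct L using (_⊔_; _⊓_; _≈²_; swap′; InP; P; _≈P_)

  orderLattice : OrderLattice.Lattice c ℓ ℓ
  orderLattice = LatticeProperties.∨-∧-orderTheoreticLattice lattice

  open OrderLattice.Lattice orderLattice
    using (_≤_; poset; x≤x∨y; y≤x∨y; ∨-least; x∧y≤x; x∧y≤y; ∧-greatest)
    renaming (refl to ≤-refl; trans to ≤-trans)
  open JoinSemilatticeProperties (OrderLattice.Lattice.joinSemilattice orderLattice)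
    using (∨-monotonic; x≤y⇒x∨y≈y)
  open MeetSemilatticeProperties (OrderLattice.Lattice.meetSemilattice orderLattice)
    using (∧-monotonic)
  open ≤-Reasoning poset

  -- LatLeq orients the natural order as x ∧ y ≈ x, the library's _≤_ as x ≈ x ∧ y.
  fromLatLeq : ∀ {x y} → LatLeq _≈_ _∧_ x y → x ≤ y
  fromLatLeq = sym

  toLatLeq : ∀ {x y} → x ≤ y → LatLeq _≈_ _∧_ x y
  toLatLeq = sym

  [x∨z]∧[y∧v]≤[x∧y]∨[z∧v] : ∀ x y z v → (x ∨ z) ∧ (y ∧ v) ≤ (x ∧ y) ∨ (z ∧ v)
  [x∨z]∧[y∧v]≤[x∧y]∨[z∧v] x y z v = begin
    (x ∨ z) ∧ (y ∧ v)              ≈⟨ ∧-distribʳ-∨ (y ∧ v) x z ⟩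
    (x ∧ (y ∧ v)) ∨ (z ∧ (y ∧ v))  ≤⟨ ∨-monotonic (∧-monotonic (≤-refl {x}) (x∧y≤x y v))
                                                  (∧-monotonic (≤-refl {z}) (x∧y≤y y v)) ⟩
    (x ∧ y) ∨ (z ∧ v)              ∎

  [x∨y]∧[z∨v]≤[x∨z]∨[y∧v] : ∀ x y z v → (x ∨ y) ∧ (z ∨ v) ≤ (x ∨ z) ∨ (y ∧ v)
  [x∨y]∧[z∨v]≤[x∨z]∨[y∧v] x y z v = begin
    (x ∨ y) ∧ (z ∨ v)              ≤⟨ ∧-monotonic (∨-monotonic (x≤x∨y x z) (≤-refl {y}))
                                                  (∨-monotonic (y≤x∨y x z) (≤-refl {v})) ⟩
    ((x ∨ z) ∨ y) ∧ ((x ∨ z) ∨ v)  ≈⟨ ∨-distribˡ-∧ (x ∨ z) y v ⟨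
    (x ∨ z) ∨ (y ∧ v)              ∎

  module _ {s : Level} (S : Carrier → Set s) where

    InP-swap′ : ∀ {p} → InP S p → InP S (swap′ p)
    InP-swap′ {x , y} p∈P w w∈S =
        toLatLeq (begin y ∧ x ≈⟨ ∧-comm y x ⟩ x ∧ y ≤⟨ fromLatLeq (proj₁ (p∈P w w∈S)) ⟩ w ∎)
      , toLatLeq (begin w ≤⟨ fromLatLeq (proj₂ (p∈P w w∈S)) ⟩ x ∨ y ≈⟨ ∨-comm x y ⟩ y ∨ x ∎)

    InP-⊔ : ∀ {p q} → InP S p → InP S q → InP S (p ⊔ q)
    InP-⊔ {x , y} {z , v} p∈P q∈P w w∈S =
        toLatLeq (begin
          (x ∨ z) ∧ (y ∧ v)  ≤⟨ [x∨z]∧[y∧v]≤[x∧y]∨[z∧v] x y z v ⟩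
          (x ∧ y) ∨ (z ∧ v)  ≤⟨ ∨-least (fromLatLeq (proj₁ (p∈P w w∈S)))
                                        (fromLatLeq (proj₁ (q∈P w w∈S))) ⟩
          w                  ∎)
      , toLatLeq (begin
          w                  ≤⟨ ∧-greatest (fromLatLeq (proj₂ (p∈P w w∈S)))
                                           (fromLatLeq (proj₂ (q∈P w w∈S))) ⟩
          (x ∨ y) ∧ (z ∨ v)  ≤⟨ [x∨y]∧[z∨v]≤[x∨z]∨[y∧v] x y z v ⟩
          (x ∨ z) ∨ (y ∧ v)  ∎)

    -- p ⊓ q is definitionally swap′ (swap′ p ⊔ swap′ q).
    InP-⊓ : ∀ {p q} → InP S p → InP S q → InP S (p ⊓ q)
    InP-⊓ p∈P q∈P = InP-swap′ (InP-⊔ (InP-swap′ p∈P) (InP-swap′ q∈P))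

    InP⇒[x∧y]≤[z∨v] : ∃ S → ∀ {x y z v} → InP S (x , y) → InP S (z , v) → x ∧ y ≤ z ∨ v
    InP⇒[x∧y]≤[z∨v] (w , w∈S) p∈P q∈P =
      ≤-trans (fromLatLeq (proj₁ (p∈P w w∈S))) (fromLatLeq (proj₂ (q∈P w w∈S)))

  ≤×≥⇒⊑ : ∀ {x y z v} → x ≤ z → v ≤ y → LatLeq _≈²_ _⊓_ (x , y) (z , v)
  ≤×≥⇒⊑ {y = y} {v = v} x≤z v≤y = toLatLeq x≤z , trans (∨-comm y v) (x≤y⇒x∨y≈y v≤y)

  ⊑⇒≤×≥ : ∀ {x y z v} → LatLeq _≈²_ _⊓_ (x , y) (z , v) → x ≤ z × v ≤ y
  ⊑⇒≤×≥ {y = y} {v = v} (x∧z≈x , y∨v≈y) =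
    fromLatLeq x∧z≈x , (begin v ≤⟨ y≤x∨y y v ⟩ y ∨ v ≈⟨ y∨v≈y ⟩ y ∎)

  twist-isDistributiveLattice : IsDistributiveLattice _≈²_ _⊔_ _⊓_
  twist-isDistributiveLattice = ×-isDistributiveLattice isDistributiveLattice
    (DistributiveLatticeProperties.∧-∨-isDistributiveLattice L)

  module _ {s : Level} (S : Carrier → Set s) where

    _⊔P_ : Op₂ (P S)
    p ⊔P q = (proj₁ p ⊔ proj₁ q) , InP-⊔ S (proj₂ p) (proj₂ q)

    _⊓P_ : Op₂ (P S)
    p ⊓P q = (proj₁ p ⊓ proj₁ q) , InP-⊓ S (proj₂ p) (proj₂ q)

    _′P : P S → P S
    p ′P = swap′ (proj₁ p) , InP-swap′ S (proj₂ p)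

    proj₁-isLatticeMonomorphism :
      IsLatticeMonomorphism (record { _≈_ = _≈P_ S ; _∨_ = _⊔P_ ; _∧_ = _⊓P_ })
                            (record { _≈_ = _≈²_ ; _∨_ = _⊔_ ; _∧_ = _⊓_ })
                            proj₁
    proj₁-isLatticeMonomorphism = record
      { isLatticeHomomorphism = record
        { isRelHomomorphism = record { cong = λ p≈q → p≈q }
        ; ∧-homo = λ _ _ → refl , refl
        ; ∨-homo = λ _ _ → refl , refl
        }
      ; injective = λ p≈q → p≈q
      }

    P-isDistributiveLattice : IsDistributiveLattice (_≈P_ S) _⊔P_ _⊓P_
    P-isDistributiveLattice =
      LatticeMonomorphism.isDistributiveLattice proj₁-isLatticeMonomorphism
        twist-isDistributiveLattice

    P-isKleeneLattice : ∃ S → IsKleeneLattice (_≈P_ S) _⊔P_ _⊓P_ _′P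
    P-isKleeneLattice w∈S = record
      { isDistributiveLattice = P-isDistributiveLattice
      ; ′-cong     = λ (x≈z , y≈v) → y≈v , x≈z
      ; antitone   = λ p⊑q → let x≤z , v≤y = ⊑⇒≤×≥ p⊑q in ≤×≥⇒⊑ v≤y x≤z
      ; involutive = λ _ → refl , refl
      ; normal     = λ ((x , y) , p∈P) ((z , v) , q∈P) →
          ≤×≥⇒⊑ (InP⇒[x∧y]≤[z∨v] S w∈S p∈P q∈P)
                (InP⇒[x∧y]≤[z∨v] S w∈S (InP-swap′ S q∈P) (InP-swap′ S p∈P))
      }

open TwistProductProperties using (InP-⊔; InP-⊓; InP-swap′; P-isDistributiveLattice; P-isKleeneLattice)

theorem3 : {c ℓ s : Level} (L : DistributiveLattice c ℓ) (S : DistributiveLattice.Carrier L → Set s)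
    → (∀ {a b} → DistributiveLattice._≈_ L a b → S a → S b)
    → ∃ S
    → let open TwistProduct L in
      -- (i) P_S(L) is closed under ⊔ and ⊓ (a sublattice of the twist-product)
      Σ (∀ {a b} → InP S a → InP S b → InP S (a ⊔ b)) λ c⊔ →
      Σ (∀ {a b} → InP S a → InP S b → InP S (a ⊓ b)) λ c⊓ →
      -- and the restricted structure is a distributive lattice
      IsDistributiveLattice (_≈P_ S)
        (λ p q → (proj₁ p ⊔ proj₁ q) , c⊔ (proj₂ p) (proj₂ q))
        (λ p q → (proj₁ p ⊓ proj₁ q) , c⊓ (proj₂ p) (proj₂ q))
      -- (ii) P_S(L) is closed under (x , y)′ = (y , x) and forms a Kleene lattice
      × Σ (∀ {a} → InP S a → InP S (swap′ a)) λ c′ →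
        IsKleeneLattice (_≈P_ S)
          (λ p q → (proj₁ p ⊔ proj₁ q) , c⊔ (proj₂ p) (proj₂ q))
          (λ p q → (proj₁ p ⊓ proj₁ q) , c⊓ (proj₂ p) (proj₂ q))
          (λ p → swap′ (proj₁ p) , c′ (proj₂ p))
-- S need not respect ≈, since it only occurs as a hypothesis in InP.
theorem3 L S _ S-nonempty =
  InP-⊔ L S , InP-⊓ L S , P-isDistributiveLattice L S ,
  InP-swap′ L S , P-isKleeneLattice L S S-nonempty
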